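{- Let $\ell \geq 1$, $s \geq 0$, $M \geq 0$ with $M \geq s$ be integers. Then \[ \sum_{n=s}^{M} (2\ell n +1) \left(2\ell^2n^2 + 2\ell n +1 -\ell^2 s^2 \right) \frac{\left(\frac{1}{\ell}\right)_{n+s} \left(\frac{1}{\ell}\right)_{n-s} \left(\frac{1}{\ell}\right)_{n}^2}{(1)_{n+s} (1)_{n-s} (1)_{n}^2}= \frac{\left(1+\frac{1}{\ell}\right)_{M+s} \left(1+\frac{1}{\ell}\right)_{M-s} \left(1+\frac{1}{\ell}\right)_{M}^2}{(1)_{M+s} (1)_{M-s} (1)_{M}^2}. \]
   Context: For a real number $a$ and integer $n\ge 0$, the rising factorial is $(a)_0=1$ and $(a)_n=a(a+1)\cdots(a+n-1)$ for $n\geq 1$. -}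

module Defs where

open import Data.Nat as ℕ using (ℕ; zero; suc)
open import Data.Integer using (+_)
open import Data.Rational using (ℚ; 0ℚ; 1ℚ; _+_; _*_; _/_; _÷_; NonZero; Positive)
open import Data.Rational.Properties
  using (pos+nonNeg⇒pos; pos*pos⇒pos; normalize-nonNeg; pos⇒nonZero)

ι : ℕ → ℚ
ι n = + n / 1

rf : ℚ → ℕ → ℚ
rf a zero    = 1ℚ
rf a (suc n) = rf a n * (a + ι n)

rf1-pos : ∀ n → Positive (rf 1ℚ n)
rf1-pos zero = _
rf1-pos (suc n) =
  let instance
        ih = rf1-pos n
        nn = normalize-nonNeg n 1
        p1 = pos+nonNeg⇒pos 1ℚ (ι n)
  in pos*pos⇒pos (rf 1ℚ n) (1ℚ + ι n)

rf1-nonZero : ∀ n → NonZero (rf 1ℚ n)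
rf1-nonZero n = pos⇒nonZero (rf 1ℚ n) {{rf1-pos n}}

ratio : ℚ → ℕ → ℚ
ratio a k = _÷_ (rf a k) (rf 1ℚ k) {{rf1-nonZero k}}

sumLen : ℕ → ℕ → (ℕ → ℚ) → ℚ
sumLen a zero      f = 0ℚ
sumLen a (suc len) f = sumLen a len f + f (a ℕ.+ len)

-- Σ_{n = s}^{M} f n, intended for s ≤ M
sumFromTo : ℕ → ℕ → (ℕ → ℚ) → ℚ
sumFromTo s M f = sumLen s (suc (M ℕ.∸ s)) f

-- Put x = ℓ = 1/a and R_c(k) = (c)_k/(1)_k.  Two shift relations of rising factorials,
--   R_{1+a}(k) = (1 + x k) R_a(k)   and   x (k+1) R_a(k+1) = (1 + x k) R_a(k),
-- show that the right-hand side at n is W(n) Q(n) = V(n+1) Q(n+1), where Q(n) is the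
-- hypergeometric factor of the summand and W, V are the products of 1 + x u, resp. x u,
-- over u ∈ {n+s, n-s, n, n}.  The summand polynomial P satisfies V(n) + P(n) = W(n), so
-- the sum telescopes; it starts at n = s because V(s) contains the factor x (s - s) = 0.
module Submission where

open import Defs
open import Data.Nat using (ℕ; NonZero; _≤_; _∸_)
open import Data.Nat using () renaming (_+_ to _+ℕ_)
open import Data.Integer using (+_)
open import Data.Rational using (ℚ; 1ℚ; _+_; _-_; _*_; _/_)
open import Relation.Binary.PropositionalEquality using (_≡_)

open import Data.Nat using (zero; suc; ≢-nonZero⁻¹)
import Data.Nat.Properties as ℕ
open import Data.Nat.Coprimality using (1-coprimeTo) renaming (sym to coprime-sym)
import Data.Integer.Properties as ℤ
open import Data.Integer using () renaming (_+_ to _+ℤ_)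
open import Data.Rational using (0ℚ; mkℚ; 1/_)
open import Data.Rational.Properties
  using (normalize-coprime; *-identityˡ; *-identityʳ; *-assoc; +-identityˡ; *-distribʳ-+;
         *-inverseˡ; *-inverseʳ)
open import Data.Rational.Solver using (module +-*-Solver)
open import Data.Empty using (⊥-elim)
open import Relation.Binary.PropositionalEquality using (refl; sym; trans; cong; cong₂; module ≡-Reasoning)

open +-*-Solver
open ≡-Reasoning

ι≡mkℚ : ∀ n → ι n ≡ mkℚ (+ n) 0 (coprime-sym (1-coprimeTo n))
ι≡mkℚ n = normalize-coprime (coprime-sym (1-coprimeTo n))

ι-+ : ∀ m n → ι (m +ℕ n) ≡ ι m + ι n
ι-+ m n rewrite ι≡mkℚ m | ι≡mkℚ n =
  cong₂ (λ i j → (i +ℤ j) / 1) (sym (ℤ.*-identityʳ (+ m))) (sym (ℤ.*-identityʳ (+ n)))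

ι-suc : ∀ n → ι (suc n) ≡ 1ℚ + ι n
ι-suc = ι-+ 1

ι-*-1/ : ∀ ℓ .{{_ : NonZero ℓ}} → ι ℓ * (+ 1 / ℓ) ≡ 1ℚ
ι-*-1/ zero {{ℓ≢0}} = ⊥-elim (≢-nonZero⁻¹ 0 {{ℓ≢0}} refl)
ι-*-1/ (suc l) rewrite ι≡mkℚ (suc l) | normalize-coprime (1-coprimeTo (suc l)) =
  *-inverseʳ (mkℚ (+ suc l) 0 (coprime-sym (1-coprimeTo (suc l))))

rf-1+ : ∀ a k → a * rf (1ℚ + a) k ≡ (a + ι k) * rf a k
rf-1+ a zero = solve 1 (λ a → a :* con 1ℚ := (a :+ con 0ℚ) :* con 1ℚ) refl a
rf-1+ a (suc k) = begin
  a * (rf (1ℚ + a) k * (1ℚ + a + ι k))    ≡⟨ sym (*-assoc a _ _) ⟩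
  a * rf (1ℚ + a) k * (1ℚ + a + ι k)      ≡⟨ cong (_* (1ℚ + a + ι k)) (rf-1+ a k) ⟩
  (a + ι k) * rf a k * (1ℚ + a + ι k)     ≡⟨ solve 3 (λ a K r →
                                               (a :+ K) :* r :* (con 1ℚ :+ a :+ K)
                                               := (a :+ (con 1ℚ :+ K)) :* (r :* (a :+ K))) refl a (ι k) (rf a k) ⟩
  (a + (1ℚ + ι k)) * (rf a k * (a + ι k)) ≡⟨ cong (λ t → (a + t) * rf a (suc k)) (sym (ι-suc k)) ⟩
  (a + ι (suc k)) * rf a (suc k)          ∎

ratio-1+ : ∀ a k → a * ratio (1ℚ + a) k ≡ (a + ι k) * ratio a k
ratio-1+ a k = begin
  a * (rf (1ℚ + a) k * g⁻¹)   ≡⟨ sym (*-assoc a _ _) ⟩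
  a * rf (1ℚ + a) k * g⁻¹     ≡⟨ cong (_* g⁻¹) (rf-1+ a k) ⟩
  (a + ι k) * rf a k * g⁻¹    ≡⟨ *-assoc (a + ι k) _ _ ⟩
  (a + ι k) * (rf a k * g⁻¹)  ∎
  where g⁻¹ = (1/ rf 1ℚ k) {{rf1-nonZero k}}

rf1-*-ratio : ∀ a k → rf 1ℚ k * ratio a k ≡ rf a k
rf1-*-ratio a k = begin
  g * (rf a k * g⁻¹)   ≡⟨ solve 3 (λ g r h → g :* (r :* h) := r :* (h :* g)) refl g (rf a k) g⁻¹ ⟩
  rf a k * (g⁻¹ * g)   ≡⟨ cong (rf a k *_) (*-inverseˡ g {{rf1-nonZero k}}) ⟩
  rf a k * 1ℚ          ≡⟨ *-identityʳ (rf a k) ⟩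
  rf a k               ∎
  where g = rf 1ℚ k; g⁻¹ = (1/ g) {{rf1-nonZero k}}

ratio-suc : ∀ a k → ι (suc k) * ratio a (suc k) ≡ (a + ι k) * ratio a k
ratio-suc a k = begin
  ι (suc k) * r              ≡⟨ cong (_* r) (ι-suc k) ⟩
  (1ℚ + ι k) * r             ≡⟨ sym (*-identityˡ _) ⟩
  1ℚ * ((1ℚ + ι k) * r)      ≡⟨ cong (_* ((1ℚ + ι k) * r)) (sym (*-inverseˡ g {{rf1-nonZero k}})) ⟩
  g⁻¹ * g * ((1ℚ + ι k) * r) ≡⟨ solve 4 (λ h g K r → h :* g :* ((con 1ℚ :+ K) :* r)
                                               := h :* (g :* (con 1ℚ :+ K) :* r)) refl g⁻¹ g (ι k) r ⟩
  g⁻¹ * (rf 1ℚ (suc k) * r)  ≡⟨ cong (g⁻¹ *_) (rf1-*-ratio a (suc k)) ⟩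
  g⁻¹ * rf a (suc k)         ≡⟨ solve 4 (λ h q a K → h :* (q :* (a :+ K)) := (a :+ K) :* (q :* h)) refl g⁻¹ (rf a k) a (ι k) ⟩
  (a + ι k) * ratio a k      ∎
  where g = rf 1ℚ k; g⁻¹ = (1/ g) {{rf1-nonZero k}}; r = ratio a (suc k)

quad : ℕ → (ℕ → ℚ) → ℕ → ℚ
quad s g n = g (n +ℕ s) * g (n ∸ s) * g n * g n

quad-cong : ∀ s {g h : ℕ → ℚ} → (∀ k → g k ≡ h k) → ∀ n → quad s g n ≡ quad s h n
quad-cong s g≗h n = cong₂ _*_ (cong₂ _*_ (cong₂ _*_ (g≗h (n +ℕ s)) (g≗h (n ∸ s))) (g≗h n)) (g≗h n)

quad-* : ∀ s (g h : ℕ → ℚ) n → quad s (λ k → g k * h k) n ≡ quad s g n * quad s h n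
quad-* s g h n = solve 6 (λ g₁ h₁ g₂ h₂ g₃ h₃ →
    g₁ :* h₁ :* (g₂ :* h₂) :* (g₃ :* h₃) :* (g₃ :* h₃)
    := g₁ :* g₂ :* g₃ :* g₃ :* (h₁ :* h₂ :* h₃ :* h₃))
  refl (g (n +ℕ s)) (h (n +ℕ s)) (g (n ∸ s)) (h (n ∸ s)) (g n) (h n)

quad-suc : ∀ {s n} {g h : ℕ → ℚ} → s ≤ n → (∀ k → g (suc k) ≡ h k) → quad s g (suc n) ≡ quad s h n
quad-suc {s} {n} {g} {h} s≤n g∘suc≗h = begin
  g (suc (n +ℕ s)) * g (suc n ∸ s) * g (suc n) * g (suc n)
    ≡⟨ cong (λ k → g (suc (n +ℕ s)) * g k * g (suc n) * g (suc n)) (ℕ.+-∸-assoc 1 s≤n) ⟩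
  quad s (λ k → g (suc k)) n
    ≡⟨ quad-cong s g∘suc≗h n ⟩
  quad s h n ∎

sumLen-telescope : ∀ (f F : ℕ → ℚ) a → f a ≡ F a →
  (∀ n → a ≤ n → F n + f (suc n) ≡ F (suc n)) → ∀ d → sumLen a (suc d) f ≡ F (a +ℕ d)
sumLen-telescope f F a base step zero = begin
  0ℚ + f (a +ℕ 0)  ≡⟨ +-identityˡ _ ⟩
  f (a +ℕ 0)       ≡⟨ cong f (ℕ.+-identityʳ a) ⟩
  f a              ≡⟨ base ⟩
  F a              ≡⟨ cong F (sym (ℕ.+-identityʳ a)) ⟩
  F (a +ℕ 0)       ∎
sumLen-telescope f F a base step (suc d) = begin
  sumLen a (suc d) f + f (a +ℕ suc d) ≡⟨ cong₂ _+_ (sumLen-telescope f F a base step d) (cong f (ℕ.+-suc a d)) ⟩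
  F (a +ℕ d) + f (suc (a +ℕ d))       ≡⟨ step (a +ℕ d) (ℕ.m≤m+n a d) ⟩
  F (suc (a +ℕ d))                    ≡⟨ cong F (sym (ℕ.+-suc a d)) ⟩
  F (a +ℕ suc d)                      ∎

sumFromTo-telescope : ∀ (f F : ℕ → ℚ) {s M} → s ≤ M → f s ≡ F s →
  (∀ n → s ≤ n → F n + f (suc n) ≡ F (suc n)) → sumFromTo s M f ≡ F M
sumFromTo-telescope f F {s} {M} s≤M base step =
  trans (sumLen-telescope f F s base step (M ∸ s)) (cong F (ℕ.m+[n∸m]≡n s≤M))

summandPolynomial : ℚ → ℚ → ℚ → ℚ
summandPolynomial x S N =
  (ι 2 * x * N + 1ℚ) * (ι 2 * x * x * N * N + ι 2 * x * N + 1ℚ - x * x * S * S)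

weight-identity : ∀ x S D {N U} → N ≡ S + D → U ≡ N + S →
  x * U * (x * D) * (x * N) * (x * N) + summandPolynomial x S N
    ≡ (1ℚ + x * U) * (1ℚ + x * D) * (1ℚ + x * N) * (1ℚ + x * N)
weight-identity x S D refl refl = solve 3 (λ x S D →
    x :* (S :+ D :+ S) :* (x :* D) :* (x :* (S :+ D)) :* (x :* (S :+ D))
      :+ (con (ι 2) :* x :* (S :+ D) :+ con 1ℚ)
         :* (con (ι 2) :* x :* x :* (S :+ D) :* (S :+ D) :+ con (ι 2) :* x :* (S :+ D) :+ con 1ℚ
             :- x :* x :* S :* S)
    := (con 1ℚ :+ x :* (S :+ D :+ S)) :* (con 1ℚ :+ x :* D)
       :* (con 1ℚ :+ x :* (S :+ D)) :* (con 1ℚ :+ x :* (S :+ D)))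
  refl x S D

module Summation (a x : ℚ) (x*a≡1 : x * a ≡ 1ℚ) (s : ℕ) where

  w v : ℕ → ℚ
  w k = 1ℚ + x * ι k
  v k = x * ι k

  summand closedForm : ℕ → ℚ
  summand n = summandPolynomial x (ι s) (ι n) * quad s (ratio a) n
  closedForm = quad s (ratio (1ℚ + a))

  x*[a+k] : ∀ k q → x * ((a + ι k) * q) ≡ w k * q
  x*[a+k] k q = begin
    x * ((a + ι k) * q)      ≡⟨ solve 4 (λ x a K q → x :* ((a :+ K) :* q) := (x :* a :+ x :* K) :* q) refl x a (ι k) q ⟩
    (x * a + x * ι k) * q    ≡⟨ cong (λ t → (t + x * ι k) * q) x*a≡1 ⟩
    w k * q                  ∎

  ratio-1+≡w*ratio : ∀ k → ratio (1ℚ + a) k ≡ w k * ratio a k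
  ratio-1+≡w*ratio k = begin
    ratio (1ℚ + a) k            ≡⟨ sym (*-identityˡ _) ⟩
    1ℚ * ratio (1ℚ + a) k       ≡⟨ cong (_* ratio (1ℚ + a) k) (sym x*a≡1) ⟩
    x * a * ratio (1ℚ + a) k    ≡⟨ *-assoc x a _ ⟩
    x * (a * ratio (1ℚ + a) k)  ≡⟨ cong (x *_) (ratio-1+ a k) ⟩
    x * ((a + ι k) * ratio a k) ≡⟨ x*[a+k] k _ ⟩
    w k * ratio a k             ∎

  v*ratio-suc : ∀ k → v (suc k) * ratio a (suc k) ≡ w k * ratio a k
  v*ratio-suc k = begin
    x * ι (suc k) * ratio a (suc k)    ≡⟨ *-assoc x _ _ ⟩
    x * (ι (suc k) * ratio a (suc k))  ≡⟨ cong (x *_) (ratio-suc a k) ⟩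
    x * ((a + ι k) * ratio a k)        ≡⟨ x*[a+k] k _ ⟩
    w k * ratio a k                    ∎

  closedForm≡ : ∀ n → closedForm n ≡ quad s w n * quad s (ratio a) n
  closedForm≡ n = trans (quad-cong s ratio-1+≡w*ratio n) (quad-* s w (ratio a) n)

  quad-w-shift : ∀ {n} → s ≤ n → quad s w n * quad s (ratio a) n ≡ quad s v (suc n) * quad s (ratio a) (suc n)
  quad-w-shift {n} s≤n = begin
    quad s w n * quad s (ratio a) n                      ≡⟨ sym (quad-* s w (ratio a) n) ⟩
    quad s (λ k → w k * ratio a k) n                     ≡⟨ sym (quad-suc {g = λ k → v k * ratio a k} s≤n v*ratio-suc) ⟩
    quad s (λ k → v k * ratio a k) (suc n)               ≡⟨ quad-* s v (ratio a) (suc n) ⟩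
    quad s v (suc n) * quad s (ratio a) (suc n)          ∎

  quad-v+polynomial≡quad-w : ∀ {m} → s ≤ m → quad s v m + summandPolynomial x (ι s) (ι m) ≡ quad s w m
  quad-v+polynomial≡quad-w {m} s≤m = weight-identity x (ι s) (ι (m ∸ s))
    (trans (cong ι (sym (ℕ.m+[n∸m]≡n s≤m))) (ι-+ s (m ∸ s))) (ι-+ m s)

  quad-v-s≡0 : quad s v s ≡ 0ℚ
  quad-v-s≡0 rewrite ℕ.n∸n≡0 s =
    solve 3 (λ x A B → x :* A :* (x :* con 0ℚ) :* (x :* B) :* (x :* B) := con 0ℚ) refl x (ι (s +ℕ s)) (ι s)

  base : summand s ≡ closedForm s
  base = begin
    P (ι s) * Q                    ≡⟨ cong (_* Q) (sym (+-identityˡ (P (ι s)))) ⟩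
    (0ℚ + P (ι s)) * Q             ≡⟨ cong (λ t → (t + P (ι s)) * Q) (sym quad-v-s≡0) ⟩
    (quad s v s + P (ι s)) * Q     ≡⟨ cong (_* Q) (quad-v+polynomial≡quad-w ℕ.≤-refl) ⟩
    quad s w s * Q                 ≡⟨ sym (closedForm≡ s) ⟩
    closedForm s                   ∎
    where P = summandPolynomial x (ι s); Q = quad s (ratio a) s

  step : ∀ n → s ≤ n → closedForm n + summand (suc n) ≡ closedForm (suc n)
  step n s≤n = begin
    closedForm n + P (ι (suc n)) * Q           ≡⟨ cong (_+ P (ι (suc n)) * Q) (trans (closedForm≡ n) (quad-w-shift s≤n)) ⟩
    quad s v (suc n) * Q + P (ι (suc n)) * Q   ≡⟨ sym (*-distribʳ-+ Q (quad s v (suc n)) (P (ι (suc n)))) ⟩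
    (quad s v (suc n) + P (ι (suc n))) * Q     ≡⟨ cong (_* Q) (quad-v+polynomial≡quad-w (ℕ.m≤n⇒m≤1+n s≤n)) ⟩
    quad s w (suc n) * Q                       ≡⟨ sym (closedForm≡ (suc n)) ⟩
    closedForm (suc n)                         ∎
    where P = summandPolynomial x (ι s); Q = quad s (ratio a) (suc n)

  sum-summand : ∀ {M} → s ≤ M → sumFromTo s M summand ≡ closedForm M
  sum-summand s≤M = sumFromTo-telescope summand closedForm s≤M base step

theorem1p2 : (ℓ s M : ℕ) → .{{_ : NonZero ℓ}} → s ≤ M →
    sumFromTo s M (λ n →
        (ι 2 * ι ℓ * ι n + 1ℚ)
      * (ι 2 * ι ℓ * ι ℓ * ι n * ι n + ι 2 * ι ℓ * ι n + 1ℚ - ι ℓ * ι ℓ * ι s * ι s)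
      * (ratio (+ 1 / ℓ) (n +ℕ s) * ratio (+ 1 / ℓ) (n ∸ s)
         * ratio (+ 1 / ℓ) n * ratio (+ 1 / ℓ) n))
    ≡ ratio (1ℚ + + 1 / ℓ) (M +ℕ s) * ratio (1ℚ + + 1 / ℓ) (M ∸ s)
      * ratio (1ℚ + + 1 / ℓ) M * ratio (1ℚ + + 1 / ℓ) M
theorem1p2 ℓ s M = Summation.sum-summand (+ 1 / ℓ) (ι ℓ) (ι-*-1/ ℓ) s
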